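{- Let $p$ be a prime and let $k,h_1,\ldots,h_l\in\mathbb{Z}^+$ with $k\geqslant\sum_{t=1}^l(p^{h_t}-1)$. Let $c_{st},c_t\in\mathbb{Z}$ for all $s\in[1,k]$, $t\in[1,l]$. Then $$\sum_{\substack{I\subseteq[1,k]\\ p^{h_t}\mid\sum_{s\in I}c_{st}-c_t\ \text{for all}\ t\in[1,l]}}(-1)^{|I|}\equiv\sum_{\substack{I_1\cup\cdots\cup I_l=[1,k]\\ |I_t|=p^{h_t}-1\ \text{for all}\ t\in[1,l]}}\ \prod_{t=1}^l\prod_{s\in I_t}c_{st}\pmod p,$$ where the right-hand sum is over ordered $l$-tuples $(I_1,\ldots,I_l)$ of subsets of $[1,k]$ with union $[1,k]$ and $|I_t|=p^{h_t}-1$ for each $t$.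
   Context: $[1,k]=\{1,\ldots,k\}$. -}

module Defs where

open import Data.Nat as ℕ using (ℕ; zero; suc; _^_)
open import Data.Integer as ℤ using (ℤ; +_; -_; 0ℤ; 1ℤ)
open import Data.Integer.Divisibility as ℤD using ()
import Data.Nat.Divisibility as ℕD
open import Data.Fin using (Fin; zero; suc)
open import Data.Fin.Subset using (Subset; inside; outside; _∪_; ⊥)
open import Data.Fin.Properties using (all?)
open import Data.Vec using (Vec; []; _∷_)
open import Data.List using (List; []; _∷_; map; concatMap; filter; foldr)
open import Relation.Nullary using (Dec; yes; no)
open import Relation.Unary using (Decidable)

allSubsets : (k : ℕ) → List (Subset k)
allSubsets zero = [] ∷ []
allSubsets (suc k) =
  concatMap (λ I → (inside ∷ I) ∷ (outside ∷ I) ∷ []) (allSubsets k)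

allTuples : ∀ {A : Set} (l : ℕ) → List A → List (Fin l → A)
allTuples zero xs = (λ ()) ∷ []
allTuples (suc l) xs =
  concatMap (λ f → map (λ a → λ { zero → a ; (suc i) → f i }) xs) (allTuples l xs)

sumℤ : List ℤ → ℤ
sumℤ = foldr ℤ._+_ 0ℤ

sumOver : ∀ {k} → Subset k → (Fin k → ℤ) → ℤ
sumOver [] f = 0ℤ
sumOver (inside ∷ I) f = f zero ℤ.+ sumOver I (λ s → f (suc s))
sumOver (outside ∷ I) f = sumOver I (λ s → f (suc s))

prodOver : ∀ {k} → Subset k → (Fin k → ℤ) → ℤ
prodOver [] f = 1ℤ
prodOver (inside ∷ I) f = f zero ℤ.* prodOver I (λ s → f (suc s))
prodOver (outside ∷ I) f = prodOver I (λ s → f (suc s))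

prodFin : ∀ {l} → (Fin l → ℤ) → ℤ
prodFin {zero} f = 1ℤ
prodFin {suc l} f = f zero ℤ.* prodFin (λ t → f (suc t))

sumFinℕ : ∀ {l} → (Fin l → ℕ) → ℕ
sumFinℕ {zero} f = 0
sumFinℕ {suc l} f = f zero ℕ.+ sumFinℕ (λ t → f (suc t))

unionFin : ∀ {l k} → (Fin l → Subset k) → Subset k
unionFin {zero} J = ⊥
unionFin {suc l} J = J zero ∪ unionFin (λ t → J (suc t))

negOnePow : ℕ → ℤ
negOnePow zero = 1ℤ
negOnePow (suc n) = - negOnePow n

infix 4 _∣ℤ?_
_∣ℤ?_ : (a b : ℤ) → Dec (a ℤD.∣ b)
a ∣ℤ? b = ℕD._∣?_ ℤ.∣ a ∣ ℤ.∣ b ∣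

-- Write f_t x = [p^(h_t) ∣ x − d_t]; the left-hand side is Σ_I (−1)^|I| Π_t f_t (Σ_{s∈I} c_st).
-- Since p divides the binomial coefficients C(q, j) for 0 < j < q = p^h, the q-th finite
-- difference of any function f is f (x + q) − f x modulo p.  Hence the q-periodic f_t has
-- vanishing q-th difference, i.e. it behaves modulo p like a polynomial of degree q − 1, and
-- its (q − 1)-th difference is 1, because f_t vanishes at d_t + 1, …, d_t + q − 1 and is 1 at
-- d_t + q.
-- For functions f_t of degrees m_t with Σ m_t ≤ k, splitting off the first element of [1,k]
-- writes the alternating sum as minus the sum, over nonempty B ⊆ [1,l], of the alternating
-- sum over the remaining k − 1 elements with f_t replaced by x ↦ f_t (x + c_1t) − f_t x for
-- t ∈ B; this lowers m_t by one and multiplies the top difference by c_1t.  By induction on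
-- k the alternating sum is (−1)^k Π_t Δ^{m_t} f_t times the sum over covers (I_1, …, I_l) of
-- [1,k] with |I_t| = m_t of Π_t Π_{s∈I_t} c_st.  There are no such covers if Σ m_t < k, and
-- if Σ m_t = k the sign is Π_t (−1)^{m_t} ≡ 1, as (−1)^q ≡ −1 modulo p.

module Submission where

open import Defs
open import Data.Bool using (Bool; true; false; _∧_; _∨_; if_then_else_; _≟_)
import Data.Bool.Properties as BoolP
open import Data.Empty using (⊥-elim)
open import Data.Fin using (Fin; zero; suc)
open import Data.Fin.Properties using (all?; ¬∀⟶∃¬)
open import Data.Fin.Subset using (Subset; ∣_∣; ⊤; _∪_)
open import Data.Integer as ℤ using (ℤ; +_; -[1+_]; -_; _+_; _*_; _-_; 0ℤ; 1ℤ)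
import Data.Integer.Properties as ℤP
open import Data.Integer.Divisibility as ℤD using ()
import Data.Integer.Divisibility.Signed as S
open import Data.Integer.Tactic.RingSolver using (solve-∀)
open import Data.List using (List; []; _∷_; map; concatMap; filter; _++_)
open import Data.Nat as ℕ using (ℕ; zero; suc; _^_; _∸_; _≤_; _<_; z≤n; s≤s)
import Data.Nat.Properties as ℕP
import Data.Nat.Divisibility as ℕD
open import Data.Nat.Primality using (Prime; euclidsLemma; prime⇒nonZero)
open import Data.Product using (_×_; _,_)
open import Data.Sum using (inj₁; inj₂)
open import Data.Vec using ([]; _∷_)
open import Data.Vec.Properties using (≡-dec)
open import Data.Vec.Functional using (tail) renaming (_∷_ to _∷ᶠ_)
open import Function using (_∘_; _∋_)
open import Level using (0ℓ)
open import Relation.Nullary using (Dec; yes; no; does; ¬_)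
open import Relation.Nullary.Decidable using (_×-dec_; dec-true; dec-false)
open import Relation.Unary using (Pred; Decidable)
open import Relation.Binary.Bundles using (Setoid)
open import Relation.Binary.Structures using (IsEquivalence)
open import Relation.Binary.PropositionalEquality
import Relation.Binary.Reasoning.Setoid

𝟙 : Bool → ℤ
𝟙 true = 1ℤ
𝟙 false = 0ℤ

𝟙-∧ : ∀ a b → 𝟙 (a ∧ b) ≡ 𝟙 a * 𝟙 b
𝟙-∧ true b = sym (ℤP.*-identityˡ (𝟙 b))
𝟙-∧ false b = refl

∑ : {A : Set} → List A → (A → ℤ) → ℤ
∑ xs g = sumℤ (map g xs)

syntax ∑ xs (λ x → g) = ∑[ x ← xs ] g

module _ {A : Set} where

  ∑-cong : (xs : List A) {g h : A → ℤ} → (∀ x → g x ≡ h x) → ∑ xs g ≡ ∑ xs h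
  ∑-cong [] e = refl
  ∑-cong (x ∷ xs) e = cong₂ _+_ (e x) (∑-cong xs e)

  ∑-++ : (xs ys : List A) (g : A → ℤ) → ∑ (xs ++ ys) g ≡ ∑ xs g + ∑ ys g
  ∑-++ [] ys g = sym (ℤP.+-identityˡ _)
  ∑-++ (x ∷ xs) ys g = trans (cong (_+_ (g x)) (∑-++ xs ys g)) (sym (ℤP.+-assoc (g x) _ _))

  ∑-0 : (xs : List A) → ∑[ x ← xs ] 0ℤ ≡ 0ℤ
  ∑-0 [] = refl
  ∑-0 (x ∷ xs) = trans (ℤP.+-identityˡ _) (∑-0 xs)

  ∑-+ : (xs : List A) (g h : A → ℤ) → ∑[ x ← xs ] (g x + h x) ≡ ∑ xs g + ∑ xs h
  ∑-+ [] g h = refl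
  ∑-+ (x ∷ xs) g h = trans (cong (_+_ (g x + h x)) (∑-+ xs g h)) (interchange (g x) (h x) _ _)
    where interchange : ∀ a b c d → (a + b) + (c + d) ≡ (a + c) + (b + d)
          interchange = solve-∀

  ∑-*ˡ : (xs : List A) (a : ℤ) (g : A → ℤ) → ∑[ x ← xs ] (a * g x) ≡ a * ∑ xs g
  ∑-*ˡ [] a g = sym (ℤP.*-zeroʳ a)
  ∑-*ˡ (x ∷ xs) a g = trans (cong (_+_ (a * g x)) (∑-*ˡ xs a g)) (sym (ℤP.*-distribˡ-+ a (g x) _))

  ∑-neg : (xs : List A) (g : A → ℤ) → ∑[ x ← xs ] (- g x) ≡ - ∑ xs g
  ∑-neg [] g = refl
  ∑-neg (x ∷ xs) g = trans (cong (_+_ (- g x)) (∑-neg xs g)) (sym (ℤP.neg-distrib-+ (g x) _))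

  ∑-filter : ∀ {ℓ} {P : Pred A ℓ} (P? : Decidable P) (xs : List A) (g : A → ℤ) →
             ∑ (filter P? xs) g ≡ ∑[ x ← xs ] (𝟙 (does (P? x)) * g x)
  ∑-filter P? [] g = refl
  ∑-filter P? (x ∷ xs) g with does (P? x)
  ... | true = cong₂ _+_ (sym (ℤP.*-identityˡ (g x))) (∑-filter P? xs g)
  ... | false = trans (∑-filter P? xs g)
                        (sym (trans (cong (_+ ∑[ y ← xs ] (𝟙 (does (P? y)) * g y)) (ℤP.*-zeroˡ (g x)))
                                   (ℤP.+-identityˡ _)))

module _ {A B : Set} where

  ∑-map : (xs : List A) (h : A → B) (g : B → ℤ) → ∑ (map h xs) g ≡ ∑[ x ← xs ] g (h x)
  ∑-map [] h g = refl
  ∑-map (x ∷ xs) h g = cong (_+_ (g (h x))) (∑-map xs h g)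

  ∑-concatMap : (xs : List A) (h : A → List B) (g : B → ℤ) →
                ∑ (concatMap h xs) g ≡ ∑[ x ← xs ] ∑ (h x) g
  ∑-concatMap [] h g = refl
  ∑-concatMap (x ∷ xs) h g = trans (∑-++ (h x) _ g) (cong (_+_ (∑ (h x) g)) (∑-concatMap xs h g))

  ∑-comm : (xs : List A) (ys : List B) (g : A → B → ℤ) →
           ∑[ x ← xs ] ∑[ y ← ys ] g x y ≡ ∑[ y ← ys ] ∑[ x ← xs ] g x y
  ∑-comm [] ys g = sym (∑-0 ys)
  ∑-comm (x ∷ xs) ys g = trans (cong (_+_ (∑ ys (g x))) (∑-comm xs ys g)) (sym (∑-+ ys (g x) _))

Fn : Set
Fn = ℤ → ℤ

Δ : ℤ → Fn → Fn
Δ a f y = f (a + y) - f y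

Δ^ : ℕ → Fn → Fn
Δ^ zero f = f
Δ^ (suc n) f = Δ^ n (Δ 1ℤ f)

Δ^-cong : ∀ n {f g : Fn} → (∀ x → f x ≡ g x) → ∀ x → Δ^ n f x ≡ Δ^ n g x
Δ^-cong zero e x = e x
Δ^-cong (suc n) e = Δ^-cong n (λ y → cong₂ _-_ (e (1ℤ + y)) (e y))

Δ^-const0 : ∀ n x → Δ^ n (λ _ → 0ℤ) x ≡ 0ℤ
Δ^-const0 zero x = refl
Δ^-const0 (suc n) x = Δ^-const0 n x

Δ^-const : ∀ n a x → Δ^ (suc n) (λ _ → a) x ≡ 0ℤ
Δ^-const n a x = trans (Δ^-cong n (λ _ → ℤP.+-inverseʳ a) x) (Δ^-const0 n x)

Δ^-shift : ∀ n (f : Fn) a x → Δ^ n (λ y → f (a + y)) x ≡ Δ^ n f (a + x)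
Δ^-shift zero f a x = refl
Δ^-shift (suc n) f a x =
  trans (Δ^-cong n (λ y → cong (λ z → f z - f (a + y)) (+-left-comm a 1ℤ y)) x) (Δ^-shift n (Δ 1ℤ f) a x)
  where +-left-comm : ∀ a b y → a + (b + y) ≡ b + (a + y)
        +-left-comm = solve-∀

Δ^-minus : ∀ n (f g : Fn) x → Δ^ n (λ y → f y - g y) x ≡ Δ^ n f x - Δ^ n g x
Δ^-minus zero f g x = refl
Δ^-minus (suc n) f g x =
  trans (Δ^-cong n (λ y → interchange (f (1ℤ + y)) (g (1ℤ + y)) (f y) (g y)) x) (Δ^-minus n (Δ 1ℤ f) (Δ 1ℤ g) x)
  where interchange : ∀ a b c d → (a - b) - (c - d) ≡ (a - c) - (b - d)
        interchange = solve-∀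

Δ^-Δ-comm : ∀ n a (f : Fn) x → Δ^ n (Δ a f) x ≡ Δ a (Δ^ n f) x
Δ^-Δ-comm n a f x = trans (Δ^-minus n (λ y → f (a + y)) f x) (cong (_- Δ^ n f x) (Δ^-shift n f a x))

Δ^-initial-zeros : ∀ n (f : Fn) x → (∀ j → j < n → f (+ j + x) ≡ 0ℤ) → Δ^ n f x ≡ f (+ n + x)
Δ^-initial-zeros zero f x _ = cong f (sym (ℤP.+-identityˡ x))
Δ^-initial-zeros (suc n) f x zeros = begin
  Δ^ n (Δ 1ℤ f) x              ≡⟨ Δ^-initial-zeros n (Δ 1ℤ f) x Δzeros ⟩
  f (1ℤ + (+ n + x)) - f (+ n + x) ≡⟨ cong₂ _-_ (cong f (sym (ℤP.+-assoc 1ℤ (+ n) x))) (zeros n (ℕP.n<1+n n)) ⟩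
  f (+ suc n + x) - 0ℤ         ≡⟨ ℤP.+-identityʳ _ ⟩
  f (+ suc n + x)              ∎
  where
  open ≡-Reasoning
  Δzeros : ∀ j → j < n → Δ 1ℤ f (+ j + x) ≡ 0ℤ
  Δzeros j j<n = cong₂ _-_ (trans (cong f (sym (ℤP.+-assoc 1ℤ (+ j) x))) (zeros (suc j) (s≤s j<n)))
                           (zeros j (ℕP.m<n⇒m<1+n j<n))

∑< : ℕ → (ℕ → ℤ) → ℤ
∑< zero g = 0ℤ
∑< (suc n) g = g 0 + ∑< n (g ∘ suc)

∑<-cong : ∀ n {g h : ℕ → ℤ} → (∀ j → g j ≡ h j) → ∑< n g ≡ ∑< n h
∑<-cong zero e = refl
∑<-cong (suc n) e = cong₂ _+_ (e 0) (∑<-cong n (e ∘ suc))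

∑<-minus : ∀ n (g h : ℕ → ℤ) → ∑< n (λ j → g j - h j) ≡ ∑< n g - ∑< n h
∑<-minus zero g h = refl
∑<-minus (suc n) g h = trans (cong (_+_ (g 0 - h 0)) (∑<-minus n (g ∘ suc) (h ∘ suc))) (interchange (g 0) (h 0) _ _)
  where interchange : ∀ a b c d → (a - b) + (c - d) ≡ (a + c) - (b + d)
        interchange = solve-∀

∑<-last : ∀ n (g : ℕ → ℤ) → ∑< (suc n) g ≡ ∑< n g + g n
∑<-last zero g = trans (ℤP.+-identityʳ (g 0)) (sym (ℤP.+-identityˡ (g 0)))
∑<-last (suc n) g = trans (cong (_+_ (g 0)) (∑<-last n (g ∘ suc))) (sym (ℤP.+-assoc (g 0) _ _))

-- Δcoeff n j = (-1)^(n-j) * (n choose j), the coefficient of f (j + x) in Δ^ n f x.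
Δcoeff : ℕ → ℕ → ℤ
Δcoeff zero zero = 1ℤ
Δcoeff zero (suc j) = 0ℤ
Δcoeff (suc n) zero = - Δcoeff n zero
Δcoeff (suc n) (suc j) = Δcoeff n j - Δcoeff n (suc j)

Δcoeff-vanishes : ∀ n j → n < j → Δcoeff n j ≡ 0ℤ
Δcoeff-vanishes zero (suc j) _ = refl
Δcoeff-vanishes (suc n) (suc j) (s≤s n<j) =
  cong₂ _-_ (Δcoeff-vanishes n j n<j) (Δcoeff-vanishes n (suc j) (ℕP.m<n⇒m<1+n n<j))

Δcoeff-diagonal : ∀ n → Δcoeff n n ≡ 1ℤ
Δcoeff-diagonal zero = refl
Δcoeff-diagonal (suc n) = cong₂ _-_ (Δcoeff-diagonal n) (Δcoeff-vanishes n (suc n) (ℕP.n<1+n n))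

Δcoeff-zero : ∀ n → Δcoeff n zero ≡ negOnePow n
Δcoeff-zero zero = refl
Δcoeff-zero (suc n) = cong -_ (Δcoeff-zero n)

Δcoeff-absorption : ∀ n j → + suc j * Δcoeff (suc n) (suc j) ≡ + suc n * Δcoeff n j
Δcoeff-absorption zero zero = refl
Δcoeff-absorption zero (suc j) = trans (ℤP.*-zeroʳ (+ suc (suc j))) (sym (ℤP.*-zeroʳ 1ℤ))
Δcoeff-absorption (suc n) zero = begin
  1ℤ * (- a - u)           ≡⟨ expand a u ⟩
  - a - 1ℤ * u             ≡⟨ cong (λ y → - a - y) (Δcoeff-absorption n 0) ⟩
  - a - (1ℤ + + n) * a     ≡⟨ collect (+ n) a ⟩
  (1ℤ + (1ℤ + + n)) * (- a) ∎
  where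
  open ≡-Reasoning
  a = Δcoeff n 0
  u = Δcoeff (suc n) 1
  expand : ∀ a u → 1ℤ * (- a - u) ≡ - a - 1ℤ * u
  expand = solve-∀
  collect : ∀ N a → - a - (1ℤ + N) * a ≡ (1ℤ + (1ℤ + N)) * (- a)
  collect = solve-∀
Δcoeff-absorption (suc n) (suc j) = begin
  (1ℤ + (1ℤ + j₊)) * ((x - y) - z)
    ≡⟨ expand j₊ x y z ⟩
  (1ℤ + j₊) * (x - y) + (x - y) - (1ℤ + (1ℤ + j₊)) * z
    ≡⟨ cong₂ (λ a b → a + (x - y) - b) (Δcoeff-absorption n j) (Δcoeff-absorption n (suc j)) ⟩
  (1ℤ + + n) * x + (x - y) - (1ℤ + + n) * y
    ≡⟨ collect (+ n) x y ⟩
  (1ℤ + (1ℤ + + n)) * (x - y) ∎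
  where
  open ≡-Reasoning
  j₊ = + j
  x = Δcoeff n j
  y = Δcoeff n (suc j)
  z = Δcoeff (suc n) (suc (suc j))
  expand : ∀ J x y z → (1ℤ + (1ℤ + J)) * ((x - y) - z) ≡ (1ℤ + J) * (x - y) + (x - y) - (1ℤ + (1ℤ + J)) * z
  expand = solve-∀
  collect : ∀ N x y → (1ℤ + N) * x + (x - y) - (1ℤ + N) * y ≡ (1ℤ + (1ℤ + N)) * (x - y)
  collect = solve-∀

Δ^-expansion : ∀ n (f : Fn) x → Δ^ n f x ≡ ∑< (suc n) (λ j → Δcoeff n j * f (+ j + x))
Δ^-expansion zero f x = trans (cong f (sym (ℤP.+-identityˡ x))) (sym (trans (ℤP.+-identityʳ _) (ℤP.*-identityˡ _)))
Δ^-expansion (suc n) f x = begin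
  Δ^ n (Δ 1ℤ f) x
    ≡⟨ Δ^-expansion n (Δ 1ℤ f) x ⟩
  ∑< (suc n) (λ j → a j * (f (1ℤ + (+ j + x)) - u j))
    ≡⟨ ∑<-cong (suc n) (λ j → trans (cong (λ y → a j * (f y - u j)) (sym (ℤP.+-assoc 1ℤ (+ j) x)))
                                    (*-distrib-- (a j) (u (suc j)) (u j))) ⟩
  ∑< (suc n) (λ j → a j * u (suc j) - a j * u j)
    ≡⟨ ∑<-minus (suc n) (λ j → a j * u (suc j)) (λ j → a j * u j) ⟩
  ∑< (suc n) (λ j → a j * u (suc j)) - (a 0 * u 0 + ∑< n (λ j → a (suc j) * u (suc j)))
    ≡⟨ cong (λ s → ∑< (suc n) (λ j → a j * u (suc j)) - (a 0 * u 0 + s)) top-term-vanishes ⟨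
  ∑< (suc n) (λ j → a j * u (suc j)) - (a 0 * u 0 + ∑< (suc n) (λ j → a (suc j) * u (suc j)))
    ≡⟨ regroup (a 0) (u 0) (∑< (suc n) (λ j → a j * u (suc j))) (∑< (suc n) (λ j → a (suc j) * u (suc j))) ⟩
  (- a 0) * u 0 + (∑< (suc n) (λ j → a j * u (suc j)) - ∑< (suc n) (λ j → a (suc j) * u (suc j)))
    ≡⟨ cong (_+_ ((- a 0) * u 0)) (∑<-minus (suc n) (λ j → a j * u (suc j)) (λ j → a (suc j) * u (suc j))) ⟨
  (- a 0) * u 0 + ∑< (suc n) (λ j → a j * u (suc j) - a (suc j) * u (suc j))
    ≡⟨ cong (_+_ ((- a 0) * u 0)) (∑<-cong (suc n) λ j → *-distribʳ-- (a j) (a (suc j)) (u (suc j))) ⟨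
  (- a 0) * u 0 + ∑< (suc n) (λ j → (a j - a (suc j)) * u (suc j)) ∎
  where
  open ≡-Reasoning
  a = Δcoeff n
  u : ℕ → ℤ
  u j = f (+ j + x)
  vanish : ∀ s y → s + 0ℤ * y ≡ s
  vanish = solve-∀
  top-term-vanishes : ∑< (suc n) (λ j → a (suc j) * u (suc j)) ≡ ∑< n (λ j → a (suc j) * u (suc j))
  top-term-vanishes = trans (∑<-last n _)
    (trans (cong (λ y → ∑< n (λ j → a (suc j) * u (suc j)) + y * u (suc n)) (Δcoeff-vanishes n (suc n) (ℕP.n<1+n n)))
           (vanish (∑< n (λ j → a (suc j) * u (suc j))) (u (suc n))))
  *-distrib-- : ∀ a b c → a * (b - c) ≡ a * b - a * c
  *-distrib-- = solve-∀
  *-distribʳ-- : ∀ a b c → (a - b) * c ≡ a * c - b * c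
  *-distribʳ-- = solve-∀
  regroup : ∀ a u s t → s - (a * u + t) ≡ (- a) * u + (s - t)
  regroup = solve-∀

prodFin-cong : ∀ {l} {g h : Fin l → ℤ} → (∀ t → g t ≡ h t) → prodFin g ≡ prodFin h
prodFin-cong {zero} e = refl
prodFin-cong {suc l} e = cong₂ _*_ (e zero) (prodFin-cong (λ t → e (suc t)))

prodFin-* : ∀ {l} (g h : Fin l → ℤ) → prodFin (λ t → g t * h t) ≡ prodFin g * prodFin h
prodFin-* {zero} g h = refl
prodFin-* {suc l} g h =
  trans (cong (_*_ (g zero * h zero)) (prodFin-* (tail g) (tail h))) (interchange (g zero) (h zero) _ _)
  where interchange : ∀ a b c d → (a * b) * (c * d) ≡ (a * c) * (b * d)
        interchange = solve-∀

prodFin-1 : ∀ l → prodFin {l} (λ _ → 1ℤ) ≡ 1ℤ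
prodFin-1 zero = refl
prodFin-1 (suc l) = trans (ℤP.*-identityˡ _) (prodFin-1 l)

negOnePow-+ : ∀ a b → negOnePow (a ℕ.+ b) ≡ negOnePow a * negOnePow b
negOnePow-+ zero b = sym (ℤP.*-identityˡ _)
negOnePow-+ (suc a) b = trans (cong -_ (negOnePow-+ a b)) (ℤP.neg-distribˡ-* (negOnePow a) (negOnePow b))

negOnePow-sumFinℕ : ∀ {l} (m : Fin l → ℕ) → negOnePow (sumFinℕ m) ≡ prodFin (λ t → negOnePow (m t))
negOnePow-sumFinℕ {zero} m = refl
negOnePow-sumFinℕ {suc l} m = trans (negOnePow-+ (m zero) _) (cong (_*_ (negOnePow (m zero))) (negOnePow-sumFinℕ (tail m)))

𝟙-all? : ∀ {l} {P : Pred (Fin l) 0ℓ} (P? : Decidable P) → 𝟙 (does (all? P?)) ≡ prodFin (λ t → 𝟙 (does (P? t)))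
𝟙-all? {zero} P? = refl
𝟙-all? {suc l} P? = trans (𝟙-∧ (does (P? zero)) _) (cong (_*_ (𝟙 (does (P? zero)))) (𝟙-all? (P? ∘ suc)))

-- Tuples are functions, and tuples built by different λ-terms are only pointwise equal.
Extensional : {A : Set} {l : ℕ} → ((Fin l → A) → ℤ) → Set
Extensional G = ∀ {u v} → (∀ t → u t ≡ v t) → G u ≡ G v

module _ {A : Set} where

  ∑-allTuples-zero : (xs : List A) (G : (Fin 0 → A) → ℤ) → Extensional G → ∀ u →
                     ∑ (allTuples 0 xs) G ≡ G u
  ∑-allTuples-zero xs G ext u = trans (ℤP.+-identityʳ _) (ext (λ ()))

  ∑-allTuples-suc : ∀ {l} (xs : List A) (G : (Fin (suc l) → A) → ℤ) → Extensional G →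
                    ∑ (allTuples (suc l) xs) G ≡ ∑[ u ← allTuples l xs ] ∑[ a ← xs ] G (a ∷ᶠ u)
  ∑-allTuples-suc {l} xs G ext = trans (∑-concatMap (allTuples l xs) _ G)
    (∑-cong (allTuples l xs) λ u → trans (∑-map xs _ G)
      (∑-cong xs λ a → ext λ { zero → refl ; (suc i) → refl }))

bools : List Bool
bools = true ∷ false ∷ []

selections : (l : ℕ) → List (Fin l → Bool)
selections l = allTuples l bools

or : ∀ {l} → (Fin l → Bool) → Bool
or {zero} b = false
or {suc l} b = b zero ∨ or (tail b)

or-cong : ∀ {l} {u v : Fin l → Bool} → (∀ t → u t ≡ v t) → or u ≡ or v
or-cong {zero} e = refl
or-cong {suc l} e = cong₂ _∨_ (e zero) (or-cong (λ t → e (suc t)))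

∑-selections-suc : ∀ {l} (G : (Fin (suc l) → Bool) → ℤ) → Extensional G →
  ∑ (selections (suc l)) G ≡ ∑[ b ← selections l ] (G (true ∷ᶠ b) + G (false ∷ᶠ b))
∑-selections-suc {l} G ext = trans (∑-allTuples-suc bools G ext)
  (∑-cong (selections l) λ b → cong (_+_ (G (true ∷ᶠ b))) (ℤP.+-identityʳ _))

module _ {l : ℕ} (B D : Fin l → ℤ) where

  choose : (Fin l → Bool) → ℤ
  choose b = prodFin (λ t → if b t then D t else B t)

  choose-ext : Extensional choose
  choose-ext e = prodFin-cong (λ t → cong (λ β → if β then D t else B t) (e t))

prodFin-+-expand : ∀ {l} (B D : Fin l → ℤ) → prodFin (λ t → B t + D t) ≡ ∑ (selections l) (choose B D)
prodFin-+-expand {zero} B D = refl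
prodFin-+-expand {suc l} B D = sym (begin
  ∑ (selections (suc l)) (choose B D)                    ≡⟨ ∑-selections-suc (choose B D) (choose-ext B D) ⟩
  ∑[ b ← selections l ] (D zero * X b + B zero * X b)    ≡⟨ ∑-+ (selections l) _ _ ⟩
  ∑[ b ← selections l ] (D zero * X b) + ∑[ b ← selections l ] (B zero * X b)
                        ≡⟨ cong₂ _+_ (∑-*ˡ (selections l) (D zero) X) (∑-*ˡ (selections l) (B zero) X) ⟩
  D zero * ∑ (selections l) X + B zero * ∑ (selections l) X
                        ≡⟨ cong (λ s → D zero * s + B zero * s) (prodFin-+-expand (tail B) (tail D)) ⟨
  D zero * P + B zero * P                                ≡⟨ collect (D zero) (B zero) P ⟩
  (B zero + D zero) * P                                  ∎)
  where
  open ≡-Reasoning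
  X = choose (tail B) (tail D)
  P = prodFin (λ t → B (suc t) + D (suc t))
  collect : ∀ d b x → d * x + b * x ≡ (b + d) * x
  collect = solve-∀

prodFin-+-minus-prodFin : ∀ {l} (B D : Fin l → ℤ) →
  prodFin (λ t → B t + D t) - prodFin B ≡ ∑[ b ← selections l ] (𝟙 (or b) * choose B D b)
prodFin-+-minus-prodFin {zero} B D = refl
prodFin-+-minus-prodFin {suc l} B D = begin
  (B zero + D zero) * P - B zero * prodFin (tail B)
        ≡⟨ regroup (B zero) (D zero) P (prodFin (tail B)) ⟩
  D zero * P + B zero * (P - prodFin (tail B))
        ≡⟨ cong₂ (λ s r → D zero * s + B zero * r) (prodFin-+-expand (tail B) (tail D))
                                                   (prodFin-+-minus-prodFin (tail B) (tail D)) ⟩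
  D zero * ∑ (selections l) X + B zero * ∑[ b ← selections l ] (𝟙 (or b) * X b)
        ≡⟨ cong₂ _+_ (∑-*ˡ (selections l) (D zero) X) (∑-*ˡ (selections l) (B zero) _) ⟨
  ∑[ b ← selections l ] (D zero * X b) + ∑[ b ← selections l ] (B zero * (𝟙 (or b) * X b))
        ≡⟨ ∑-+ (selections l) _ _ ⟨
  ∑[ b ← selections l ] (D zero * X b + B zero * (𝟙 (or b) * X b))
        ≡⟨ ∑-cong (selections l) (λ b → cong₂ _+_ (ℤP.*-identityˡ (D zero * X b)) (left-comm (𝟙 (or b)) (B zero) (X b))) ⟨
  ∑[ b ← selections l ] (𝟙 true * (D zero * X b) + 𝟙 (or b) * (B zero * X b))
        ≡⟨ ∑-selections-suc (λ b → 𝟙 (or b) * choose B D b) (λ e → cong₂ _*_ (cong 𝟙 (or-cong e)) (choose-ext B D e)) ⟨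
  ∑[ b ← selections (suc l) ] (𝟙 (or b) * choose B D b) ∎
  where
  open ≡-Reasoning
  X = choose (tail B) (tail D)
  P = prodFin (λ t → B (suc t) + D (suc t))
  regroup : ∀ b d x y → (b + d) * x - b * y ≡ d * x + b * (x - y)
  regroup = solve-∀
  left-comm : ∀ a b c → a * (b * c) ≡ b * (a * c)
  left-comm = solve-∀

alternatingSum : ∀ k {l} → (Fin l → Fn) → (Fin k → Fin l → ℤ) → ℤ
alternatingSum k f c = ∑[ I ← allSubsets k ] (negOnePow ∣ I ∣ * prodFin (λ t → f t (sumOver I (λ s → c s t))))

selectiveΔ : ∀ {l} → (Fin l → Fn) → (Fin l → ℤ) → (Fin l → Bool) → Fin l → Fn
selectiveΔ f a b t y = if b t then Δ (a t) (f t) y else f t y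

alternatingSum-suc : ∀ k {l} (f : Fin l → Fn) (c : Fin (suc k) → Fin l → ℤ) →
  alternatingSum (suc k) f c
    ≡ - ∑[ b ← selections l ] (𝟙 (or b) * alternatingSum k (selectiveΔ f (c zero) b) (tail c))
alternatingSum-suc k {l} f c = begin
  alternatingSum (suc k) f c
      ≡⟨ ∑-concatMap (allSubsets k) _ _ ⟩
  ∑[ I ← allSubsets k ] ((- sign I) * prodFin (λ t → f t (c zero t + S t I)) + (sign I * prodFin (λ t → f t (S t I)) + 0ℤ))
      ≡⟨ ∑-cong (allSubsets k) split ⟩
  ∑[ I ← allSubsets k ] (- ∑[ b ← selections l ] (𝟙 (or b) * (sign I * X b I)))
      ≡⟨ ∑-neg (allSubsets k) _ ⟩
  - ∑[ I ← allSubsets k ] ∑[ b ← selections l ] (𝟙 (or b) * (sign I * X b I))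
      ≡⟨ cong -_ (∑-comm (allSubsets k) (selections l) _) ⟩
  - ∑[ b ← selections l ] ∑[ I ← allSubsets k ] (𝟙 (or b) * (sign I * X b I))
      ≡⟨ cong -_ (∑-cong (selections l) λ b → ∑-*ˡ (allSubsets k) (𝟙 (or b)) _) ⟩
  - ∑[ b ← selections l ] (𝟙 (or b) * alternatingSum k (selectiveΔ f (c zero) b) (tail c)) ∎
  where
  open ≡-Reasoning
  S : Fin l → Subset k → ℤ
  S t I = sumOver I (λ s → c (suc s) t)
  sign : Subset k → ℤ
  sign I = negOnePow ∣ I ∣
  X : (Fin l → Bool) → Subset k → ℤ
  X b I = prodFin (λ t → selectiveΔ f (c zero) b t (S t I))
  B D : Subset k → Fin l → ℤ
  B I t = f t (S t I)
  D I t = Δ (c zero t) (f t) (S t I)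
  reassemble : ∀ a b → a ≡ b + (a - b)
  reassemble = solve-∀
  left-comm : ∀ a b c → a * (b * c) ≡ b * (a * c)
  left-comm = solve-∀
  difference : ∀ n x y → (- n) * x + (n * y + 0ℤ) ≡ - (n * (x - y))
  difference = solve-∀
  split : ∀ I → (- sign I) * prodFin (λ t → f t (c zero t + S t I)) + (sign I * prodFin (λ t → f t (S t I)) + 0ℤ)
              ≡ - ∑[ b ← selections l ] (𝟙 (or b) * (sign I * X b I))
  split I = begin
    (- sign I) * prodFin (λ t → f t (c zero t + S t I)) + (sign I * prodFin (λ t → f t (S t I)) + 0ℤ)
        ≡⟨ difference (sign I) _ _ ⟩
    - (sign I * (prodFin (λ t → f t (c zero t + S t I)) - prodFin (λ t → f t (S t I))))
        ≡⟨ cong (λ x → - (sign I * (x - prodFin (λ t → f t (S t I)))))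
                (prodFin-cong λ t → reassemble (f t (c zero t + S t I)) (f t (S t I))) ⟩
    - (sign I * (prodFin (λ t → B I t + D I t) - prodFin (B I)))
        ≡⟨ cong (λ x → - (sign I * x)) (prodFin-+-minus-prodFin (B I) (D I)) ⟩
    - (sign I * ∑[ b ← selections l ] (𝟙 (or b) * X b I))
        ≡⟨ cong -_ (∑-*ˡ (selections l) (sign I) _) ⟨
    - ∑[ b ← selections l ] (sign I * (𝟙 (or b) * X b I))
        ≡⟨ cong -_ (∑-cong (selections l) λ b → left-comm (sign I) (𝟙 (or b)) (X b I)) ⟩
    - ∑[ b ← selections l ] (𝟙 (or b) * (sign I * X b I)) ∎

does-⇔ : {A B : Set} (a? : Dec A) (b? : Dec B) → (A → B) → (B → A) → does a? ≡ does b?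
does-⇔ (yes a) b? f g = sym (dec-true b? (f a))
does-⇔ (no ¬a) b? f g = sym (dec-false b? (¬a ∘ g))

module _ {A B C : Set} (_⊗_ : A → B → C) (xs : List A) (ys : List B) (zs : List C)
         (∑zs : ∀ g → ∑ zs g ≡ ∑[ y ← ys ] ∑[ x ← xs ] g (x ⊗ y)) where

  ∑-allTuples-⊗ : ∀ l (G : (Fin l → C) → ℤ) → Extensional G →
    ∑ (allTuples l zs) G ≡ ∑[ v ← allTuples l ys ] ∑[ u ← allTuples l xs ] G (λ t → u t ⊗ v t)
  ∑-allTuples-⊗ zero G ext =
    trans (ℤP.+-identityʳ _) (sym (trans (ℤP.+-identityʳ _) (trans (ℤP.+-identityʳ _) (ext (λ ())))))
  ∑-allTuples-⊗ (suc l) G ext = begin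
    ∑ (allTuples (suc l) zs) G
      ≡⟨ ∑-allTuples-suc zs G ext ⟩
    ∑[ w ← allTuples l zs ] ∑[ z ← zs ] G (z ∷ᶠ w)
      ≡⟨ ∑-cong (allTuples l zs) (λ w → ∑zs (λ z → G (z ∷ᶠ w))) ⟩
    ∑ (allTuples l zs) H
      ≡⟨ ∑-allTuples-⊗ l H H-ext ⟩
    ∑[ v ← allTuples l ys ] ∑[ u ← allTuples l xs ] ∑[ y ← ys ] ∑[ x ← xs ] G ((x ⊗ y) ∷ᶠ (λ t → u t ⊗ v t))
      ≡⟨ ∑-cong (allTuples l ys) (λ v → ∑-comm (allTuples l xs) ys _) ⟩
    ∑[ v ← allTuples l ys ] ∑[ y ← ys ] ∑[ u ← allTuples l xs ] ∑[ x ← xs ] G ((x ⊗ y) ∷ᶠ (λ t → u t ⊗ v t))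
      ≡⟨ ∑-cong (allTuples l ys) (λ v → ∑-cong ys λ y → ∑-cong (allTuples l xs) λ u → ∑-cong xs λ x →
           ext λ { zero → refl ; (suc t) → refl }) ⟩
    ∑[ v ← allTuples l ys ] ∑[ y ← ys ] ∑[ u ← allTuples l xs ] ∑[ x ← xs ] G (λ t → (x ∷ᶠ u) t ⊗ (y ∷ᶠ v) t)
      ≡⟨ ∑-cong (allTuples l ys) (λ v → ∑-cong ys λ y →
           ∑-allTuples-suc xs _ λ e → ext λ t → cong (_⊗ (y ∷ᶠ v) t) (e t)) ⟨
    ∑[ v ← allTuples l ys ] ∑[ y ← ys ] ∑[ u ← allTuples (suc l) xs ] G (λ t → u t ⊗ (y ∷ᶠ v) t)
      ≡⟨ ∑-allTuples-suc ys _ (λ e → ∑-cong (allTuples (suc l) xs) λ u → ext λ t → cong (u t ⊗_) (e t)) ⟨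
    ∑[ v ← allTuples (suc l) ys ] ∑[ u ← allTuples (suc l) xs ] G (λ t → u t ⊗ v t) ∎
    where
    open ≡-Reasoning
    H : (Fin l → C) → ℤ
    H w = ∑[ y ← ys ] ∑[ x ← xs ] G ((x ⊗ y) ∷ᶠ w)
    H-ext : Extensional H
    H-ext e = ∑-cong ys λ y → ∑-cong xs λ x → ext λ { zero → refl ; (suc t) → e t }

bit : Bool → ℕ
bit true = 1
bit false = 0

module _ {l : ℕ} where

  infix 4 _≼_ _≼?_
  _≼_ : (Fin l → Bool) → (Fin l → ℕ) → Set
  b ≼ m = ∀ t → bit (b t) ≤ m t

  _≼?_ : ∀ b m → Dec (b ≼ m)
  b ≼? m = all? (λ t → bit (b t) ℕ.≤? m t)

  infixl 6 _∸ᵇ_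
  _∸ᵇ_ : (Fin l → ℕ) → (Fin l → Bool) → Fin l → ℕ
  (m ∸ᵇ b) t = m t ∸ bit (b t)

  module _ {k : ℕ} where

    IsCover : (Fin l → ℕ) → (Fin l → Subset k) → Set
    IsCover m J = unionFin J ≡ ⊤ × (∀ t → ∣ J t ∣ ≡ m t)

    isCover? : (m : Fin l → ℕ) → Decidable (IsCover m)
    isCover? m J = ≡-dec _≟_ (unionFin J) ⊤ ×-dec all? (λ t → ∣ J t ∣ ℕ.≟ m t)

    weight : (Fin k → Fin l → ℤ) → (Fin l → Subset k) → ℤ
    weight c J = prodFin (λ t → prodOver (J t) (λ s → c s t))

coverSum : ∀ k {l} → (Fin l → ℕ) → (Fin k → Fin l → ℤ) → ℤ
coverSum k {l} m c = ∑ (filter (isCover? m) (allTuples l (allSubsets k))) (weight c)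

unionFin-cong : ∀ {k l} {J J' : Fin l → Subset k} → (∀ t → J t ≡ J' t) → unionFin J ≡ unionFin J'
unionFin-cong {l = zero} e = refl
unionFin-cong {l = suc l} e = cong₂ _∪_ (e zero) (unionFin-cong (λ t → e (suc t)))

unionFin-∷ : ∀ {k l} (b : Fin l → Bool) (J : Fin l → Subset k) → unionFin (λ t → b t ∷ J t) ≡ or b ∷ unionFin J
unionFin-∷ {l = zero} b J = refl
unionFin-∷ {l = suc l} b J = cong ((b zero ∷ J zero) ∪_) (unionFin-∷ (tail b) (tail J))

∧-interchange : ∀ a b c d → (a ∧ b) ∧ (c ∧ d) ≡ (a ∧ c) ∧ (b ∧ d)
∧-interchange true true c d = refl
∧-interchange true false c d = sym (BoolP.∧-zeroʳ c)
∧-interchange false b c d = refl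

size-∷ : ∀ {k} β (I : Subset k) n →
         does (∣ β ∷ I ∣ ℕ.≟ n) ≡ does (bit β ℕ.≤? n) ∧ does (∣ I ∣ ℕ.≟ n ∸ bit β)
size-∷ true I zero = refl
size-∷ true I (suc n) = refl
size-∷ false I n = refl

sizes-∷ : ∀ {k l} (b : Fin l → Bool) (J : Fin l → Subset k) (m : Fin l → ℕ) →
  does (all? λ t → ∣ b t ∷ J t ∣ ℕ.≟ m t) ≡ does (b ≼? m) ∧ does (all? λ t → ∣ J t ∣ ℕ.≟ (m ∸ᵇ b) t)
sizes-∷ {l = zero} b J m = refl
sizes-∷ {l = suc l} b J m =
  trans (cong₂ _∧_ (size-∷ (b zero) (J zero) (m zero)) (sizes-∷ (tail b) (tail J) (tail m)))
        (∧-interchange (does (bit (b zero) ℕ.≤? m zero)) _ (does (tail b ≼? tail m)) _)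

≡⊤-∷ : ∀ {k} x (v : Subset k) → does (≡-dec _≟_ (x ∷ v) ⊤) ≡ x ∧ does (≡-dec _≟_ v ⊤)
≡⊤-∷ true v = refl
≡⊤-∷ false v = refl

isCover-∷ : ∀ {k l} (m : Fin l → ℕ) (b : Fin l → Bool) (J : Fin l → Subset k) →
  𝟙 (does (isCover? m (λ t → b t ∷ J t))) ≡ 𝟙 (or b) * (𝟙 (does (b ≼? m)) * 𝟙 (does (isCover? (m ∸ᵇ b) J)))
isCover-∷ m b J = begin
  𝟙 (does (≡-dec _≟_ (unionFin (λ t → b t ∷ J t)) ⊤) ∧ does (all? λ t → ∣ b t ∷ J t ∣ ℕ.≟ m t))
    ≡⟨ cong 𝟙 (cong₂ _∧_ (trans (cong (λ v → does (≡-dec _≟_ v ⊤)) (unionFin-∷ b J)) (≡⊤-∷ (or b) (unionFin J)))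
                         (sizes-∷ b J m)) ⟩
  𝟙 ((or b ∧ U) ∧ (does (b ≼? m) ∧ S))
    ≡⟨ cong 𝟙 (regroup (or b) U (does (b ≼? m)) S) ⟩
  𝟙 (or b ∧ (does (b ≼? m) ∧ (U ∧ S)))
    ≡⟨ trans (𝟙-∧ (or b) _) (cong (𝟙 (or b) *_) (𝟙-∧ (does (b ≼? m)) _)) ⟩
  𝟙 (or b) * (𝟙 (does (b ≼? m)) * 𝟙 (does (isCover? (m ∸ᵇ b) J))) ∎
  where
  open ≡-Reasoning
  U = does (≡-dec _≟_ (unionFin J) ⊤)
  S = does (all? λ t → ∣ J t ∣ ℕ.≟ (m ∸ᵇ b) t)
  regroup : ∀ x u a s → (x ∧ u) ∧ (a ∧ s) ≡ x ∧ (a ∧ (u ∧ s))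
  regroup false u a s = refl
  regroup true true a s = refl
  regroup true false a s = sym (BoolP.∧-zeroʳ a)

prodOver-∷ : ∀ {k} β (I : Subset k) (g : Fin (suc k) → ℤ) →
  prodOver (β ∷ I) g ≡ (if β then g zero else 1ℤ) * prodOver I (tail g)
prodOver-∷ true I g = refl
prodOver-∷ false I g = sym (ℤP.*-identityˡ _)

weight-∷ : ∀ {k l} (c : Fin (suc k) → Fin l → ℤ) (b : Fin l → Bool) (J : Fin l → Subset k) →
  weight c (λ t → b t ∷ J t) ≡ choose (λ _ → 1ℤ) (c zero) b * weight (tail c) J
weight-∷ c b J = trans (prodFin-cong λ t → prodOver-∷ (b t) (J t) (λ s → c s t))
                       (prodFin-* (λ t → if b t then c zero t else 1ℤ) (λ t → prodOver (J t) (λ s → c (suc s) t)))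

module _ {k l : ℕ} (m : Fin l → ℕ) (c : Fin k → Fin l → ℤ) where

  coverTerm : (Fin l → Subset k) → ℤ
  coverTerm J = 𝟙 (does (isCover? m J)) * weight c J

  coverTerm-ext : Extensional coverTerm
  coverTerm-ext {J} {J'} e = cong₂ _*_
    (cong 𝟙 (does-⇔ (isCover? m J) (isCover? m J') (respect e) (respect (sym ∘ e))))
    (prodFin-cong λ t → cong (λ I → prodOver I (λ s → c s t)) (e t))
    where
    respect : ∀ {J J'} → (∀ t → J t ≡ J' t) → IsCover m J → IsCover m J'
    respect e (∪≡⊤ , sizes) = trans (sym (unionFin-cong e)) ∪≡⊤ , λ t → trans (cong ∣_∣ (sym (e t))) (sizes t)

  coverSum-as-∑ : coverSum k m c ≡ ∑ (allTuples l (allSubsets k)) coverTerm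
  coverSum-as-∑ = ∑-filter (isCover? m) (allTuples l (allSubsets k)) (weight c)

coverSum-suc : ∀ k {l} (m : Fin l → ℕ) (c : Fin (suc k) → Fin l → ℤ) →
  coverSum (suc k) m c
    ≡ ∑[ b ← selections l ]
        (𝟙 (or b) * (𝟙 (does (b ≼? m)) * (choose (λ _ → 1ℤ) (c zero) b * coverSum k (m ∸ᵇ b) (tail c))))
coverSum-suc k {l} m c = begin
  coverSum (suc k) m c
    ≡⟨ coverSum-as-∑ m c ⟩
  ∑ (allTuples l (allSubsets (suc k))) (coverTerm m c)
    ≡⟨ ∑-allTuples-⊗ _∷_ bools (allSubsets k) (allSubsets (suc k)) (∑-concatMap (allSubsets k) _) l
                     (coverTerm m c) (coverTerm-ext m c) ⟩
  ∑[ J ← tuples ] ∑[ b ← selections l ] coverTerm m c (λ t → b t ∷ J t)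
    ≡⟨ ∑-cong tuples (λ J → ∑-cong (selections l) (factor J)) ⟩
  ∑[ J ← tuples ] ∑[ b ← selections l ] (𝟙 (or b) * (𝟙 (does (b ≼? m)) * (C b * coverTerm (m ∸ᵇ b) (tail c) J)))
    ≡⟨ ∑-comm tuples (selections l) _ ⟩
  ∑[ b ← selections l ] ∑[ J ← tuples ] (𝟙 (or b) * (𝟙 (does (b ≼? m)) * (C b * coverTerm (m ∸ᵇ b) (tail c) J)))
    ≡⟨ ∑-cong (selections l) pull-out ⟩
  ∑[ b ← selections l ] (𝟙 (or b) * (𝟙 (does (b ≼? m)) * (C b * coverSum k (m ∸ᵇ b) (tail c)))) ∎
  where
  open ≡-Reasoning
  tuples = allTuples l (allSubsets k)
  C = choose (λ _ → 1ℤ) (c zero)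
  pull-out : ∀ b → ∑[ J ← tuples ] (𝟙 (or b) * (𝟙 (does (b ≼? m)) * (C b * coverTerm (m ∸ᵇ b) (tail c) J)))
                  ≡ 𝟙 (or b) * (𝟙 (does (b ≼? m)) * (C b * coverSum k (m ∸ᵇ b) (tail c)))
  pull-out b = begin
    ∑[ J ← tuples ] (𝟙 (or b) * (𝟙 (does (b ≼? m)) * (C b * T J)))
      ≡⟨ ∑-*ˡ tuples (𝟙 (or b)) _ ⟩
    𝟙 (or b) * ∑[ J ← tuples ] (𝟙 (does (b ≼? m)) * (C b * T J))
      ≡⟨ cong (𝟙 (or b) *_) (∑-*ˡ tuples (𝟙 (does (b ≼? m))) _) ⟩
    𝟙 (or b) * (𝟙 (does (b ≼? m)) * ∑[ J ← tuples ] (C b * T J))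
      ≡⟨ cong (λ x → 𝟙 (or b) * (𝟙 (does (b ≼? m)) * x)) (∑-*ˡ tuples (C b) T) ⟩
    𝟙 (or b) * (𝟙 (does (b ≼? m)) * (C b * ∑ tuples T))
      ≡⟨ cong (λ x → 𝟙 (or b) * (𝟙 (does (b ≼? m)) * (C b * x))) (coverSum-as-∑ (m ∸ᵇ b) (tail c)) ⟨
    𝟙 (or b) * (𝟙 (does (b ≼? m)) * (C b * coverSum k (m ∸ᵇ b) (tail c))) ∎
    where T = coverTerm (m ∸ᵇ b) (tail c)
  regroup : ∀ o a i w x → (o * (a * i)) * (w * x) ≡ o * (a * (w * (i * x)))
  regroup = solve-∀
  factor : ∀ J b → coverTerm m c (λ t → b t ∷ J t)
                   ≡ 𝟙 (or b) * (𝟙 (does (b ≼? m)) * (C b * coverTerm (m ∸ᵇ b) (tail c) J))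
  factor J b = trans (cong₂ _*_ (isCover-∷ m b J) (weight-∷ c b J))
                     (regroup (𝟙 (or b)) (𝟙 (does (b ≼? m))) _ (C b) _)

sumFinℕ≡0⇒≡0 : ∀ {l} (m : Fin l → ℕ) → sumFinℕ m ≡ 0 → ∀ t → m t ≡ 0
sumFinℕ≡0⇒≡0 m eq zero = ℕP.m+n≡0⇒m≡0 (m zero) eq
sumFinℕ≡0⇒≡0 m eq (suc t) = sumFinℕ≡0⇒≡0 (tail m) (ℕP.m+n≡0⇒n≡0 (m zero) eq) t

sum-∸ᵇ≤ : ∀ {l} (m : Fin l → ℕ) (b : Fin l → Bool) → sumFinℕ (m ∸ᵇ b) ≤ sumFinℕ m
sum-∸ᵇ≤ {zero} m b = z≤n
sum-∸ᵇ≤ {suc l} m b = ℕP.+-mono-≤ (ℕP.m∸n≤m (m zero) (bit (b zero))) (sum-∸ᵇ≤ (tail m) (tail b))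

sum-∸ᵇ< : ∀ {l} (m : Fin l → ℕ) (b : Fin l → Bool) → or b ≡ true → b ≼ m → sumFinℕ (m ∸ᵇ b) < sumFinℕ m
sum-∸ᵇ< {suc l} m b or≡true b≼m = step (b zero) (m zero) or≡true (b≼m zero)
  where
  step : ∀ β n → β ∨ or (tail b) ≡ true → bit β ≤ n →
         suc (n ∸ bit β ℕ.+ sumFinℕ (tail m ∸ᵇ tail b)) ≤ n ℕ.+ sumFinℕ (tail m)
  step true (suc n) _ _ = s≤s (ℕP.+-monoʳ-≤ n (sum-∸ᵇ≤ (tail m) (tail b)))
  step false n or≡true _ = ℕP.+-monoʳ-< n (sum-∸ᵇ< (tail m) (tail b) or≡true (b≼m ∘ suc))

∑-allTuples-single : ∀ {A : Set} l (x : A) (G : (Fin l → A) → ℤ) → Extensional G →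
                     ∑ (allTuples l (x ∷ [])) G ≡ G (λ _ → x)
∑-allTuples-single zero x G ext = ∑-allTuples-zero (x ∷ []) G ext _
∑-allTuples-single (suc l) x G ext = begin
  ∑ (allTuples (suc l) (x ∷ [])) G               ≡⟨ ∑-allTuples-suc (x ∷ []) G ext ⟩
  ∑[ u ← allTuples l (x ∷ []) ] (G (x ∷ᶠ u) + 0ℤ)
    ≡⟨ ∑-allTuples-single l x _ (λ e → cong (_+ 0ℤ) (ext λ { zero → refl ; (suc t) → e t })) ⟩
  G (x ∷ᶠ (λ _ → x)) + 0ℤ                        ≡⟨ ℤP.+-identityʳ _ ⟩
  G (x ∷ᶠ (λ _ → x))                             ≡⟨ ext (λ { zero → refl ; (suc t) → refl }) ⟩
  G (λ _ → x)                                    ∎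
  where open ≡-Reasoning

coverSum-zero : ∀ {l} (m : Fin l → ℕ) (c : Fin 0 → Fin l → ℤ) → (∀ t → m t ≡ 0) → coverSum 0 m c ≡ 1ℤ
coverSum-zero {l} m c m≡0 = begin
  coverSum 0 m c                                          ≡⟨ coverSum-as-∑ m c ⟩
  ∑ (allTuples l (allSubsets 0)) (coverTerm m c)
    ≡⟨ ∑-allTuples-single l (Subset 0 ∋ []) (coverTerm m c) (coverTerm-ext m c) ⟩
  𝟙 (does (isCover? m J₀)) * prodFin {l} (λ _ → 1ℤ)
    ≡⟨ cong₂ _*_ (cong 𝟙 (dec-true (isCover? m J₀) isCover)) (prodFin-1 l) ⟩
  1ℤ                                                      ∎
  where
  open ≡-Reasoning
  empty : (v : Subset 0) → v ≡ ⊤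
  empty [] = refl
  J₀ : Fin l → Subset 0
  J₀ _ = []
  isCover : IsCover m J₀
  isCover = empty _ , λ t → sym (m≡0 t)

coverSum-vanishes : ∀ k {l} (m : Fin l → ℕ) (c : Fin k → Fin l → ℤ) → sumFinℕ m < k → coverSum k m c ≡ 0ℤ
coverSum-vanishes (suc k) {l} m c Σm≤k =
  trans (coverSum-suc k m c) (trans (∑-cong (selections l) term) (∑-0 (selections l)))
  where
  rest : (Fin l → Bool) → ℤ
  rest b = choose (λ _ → 1ℤ) (c zero) b * coverSum k (m ∸ᵇ b) (tail c)
  term : ∀ b → 𝟙 (or b) * (𝟙 (does (b ≼? m)) * rest b) ≡ 0ℤ
  term b with or b in or≡ | b ≼? m
  ... | false | _ = ℤP.*-zeroˡ (𝟙 (does (b ≼? m)) * rest b)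
  ... | true | no b⋠m = begin
    1ℤ * (𝟙 (does (b ≼? m)) * rest b) ≡⟨ cong (λ x → 1ℤ * (𝟙 x * rest b)) (dec-false (b ≼? m) b⋠m) ⟩
    1ℤ * (0ℤ * rest b)                ≡⟨ trans (ℤP.*-identityˡ (0ℤ * rest b)) (ℤP.*-zeroˡ (rest b)) ⟩
    0ℤ                                ∎
    where open ≡-Reasoning
  ... | true | yes b≼m = begin
    1ℤ * (𝟙 (does (b ≼? m)) * (C * coverSum k (m ∸ᵇ b) (tail c)))
      ≡⟨ cong₂ (λ x y → 1ℤ * (𝟙 x * (C * y))) (dec-true (b ≼? m) b≼m)
               (coverSum-vanishes k (m ∸ᵇ b) (tail c) (ℕP.<-≤-trans (sum-∸ᵇ< m b or≡ b≼m) (ℕP.≤-pred Σm≤k))) ⟩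
    1ℤ * (1ℤ * (C * 0ℤ))
      ≡⟨ trans (ℤP.*-identityˡ _) (trans (ℤP.*-identityˡ _) (ℤP.*-zeroʳ C)) ⟩
    0ℤ ∎
    where
    open ≡-Reasoning
    C = choose (λ _ → 1ℤ) (c zero) b

hits : ℕ → ℤ → Fn
hits q d x = 𝟙 (does (+ q ∣ℤ? x - d))

hits-periodic : ∀ q d x → hits q d (+ q + x) ≡ hits q d x
hits-periodic q d x = cong 𝟙 (does-⇔ (+ q ∣ℤ? (+ q + x) - d) (+ q ∣ℤ? x - d)
  (λ q∣ → S.∣⇒∣ᵤ (S.∣m+n∣m⇒∣n {n = x - d} (subst (+ q S.∣_) (assoc (+ q) x d) (S.∣ᵤ⇒∣ q∣)) S.∣-refl))
  (λ q∣ → S.∣⇒∣ᵤ (subst (+ q S.∣_) (sym (assoc (+ q) x d)) (S.∣m∣n⇒∣m+n {n = x - d} S.∣-refl (S.∣ᵤ⇒∣ q∣)))))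
  where assoc : ∀ q x d → (q + x) - d ≡ q + (x - d)
        assoc = solve-∀

∑-filter-divisible≡alternatingSum : ∀ k {l} (q : Fin l → ℕ) (d : Fin l → ℤ) (c : Fin k → Fin l → ℤ) →
  ∑ (filter (λ I → all? (λ t → + q t ∣ℤ? (sumOver I (λ s → c s t) - d t))) (allSubsets k)) (λ I → negOnePow ∣ I ∣)
    ≡ alternatingSum k (λ t → hits (q t) (d t)) c
∑-filter-divisible≡alternatingSum k q d c =
  trans (∑-filter divisible? (allSubsets k) _) (∑-cong (allSubsets k) λ I →
    trans (ℤP.*-comm (𝟙 (does (divisible? I))) (negOnePow ∣ I ∣)) (cong (negOnePow ∣ I ∣ *_) (𝟙-all? (divisible-at I))))
  where
  divisible-at = λ (I : Subset k) t → + q t ∣ℤ? (sumOver I (λ s → c s t) - d t)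
  divisible? = λ I → all? (divisible-at I)

prime-power∣*⇒∣ : ∀ {p} → Prime p → ∀ h {m n} → p ^ h ℕD.∣ m ℕ.* n → ¬ p ℕD.∣ n → p ^ h ℕD.∣ m
prime-power∣*⇒∣ p-prime zero _ _ = ℕD.1∣ _
prime-power∣*⇒∣ {p} p-prime (suc h) {m} {n} pʰ⁺¹∣mn p∤n
  with euclidsLemma m n p-prime (ℕD.∣-trans (ℕD.m∣m*n (p ^ h)) pʰ⁺¹∣mn)
... | inj₂ p∣n = ⊥-elim (p∤n p∣n)
... | inj₁ (ℕD.divides q refl) = subst (p ^ suc h ℕD.∣_) (ℕP.*-comm p q) (ℕD.*-monoʳ-∣ p pʰ∣q)
  where
  pʰ∣q : p ^ h ℕD.∣ q
  pʰ∣q = prime-power∣*⇒∣ p-prime h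
    (ℕD.*-cancelˡ-∣ p {{prime⇒nonZero p-prime}}
      (subst (p ^ suc h ℕD.∣_) (trans (cong (ℕ._* n) (ℕP.*-comm q p)) (ℕP.*-assoc p q n)) pʰ⁺¹∣mn))
    p∤n

module Modulo (p : ℕ) where

  infix 4 _≈_
  record _≈_ (a b : ℤ) : Set where
    constructor ≈-intro
    field p∣a-b : + p S.∣ a - b
  open _≈_ public

  ∣⇒≈0 : ∀ {a} → + p S.∣ a → a ≈ 0ℤ
  ∣⇒≈0 {a} p∣a = ≈-intro (subst (+ p S.∣_) (sym (ℤP.+-identityʳ a)) p∣a)

  ≈-reflexive : ∀ {a b} → a ≡ b → a ≈ b
  ≈-reflexive {a} refl = ≈-intro (subst (+ p S.∣_) (sym (ℤP.+-inverseʳ a)) (S.divides 0ℤ refl))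

  ≈-refl : ∀ {a} → a ≈ a
  ≈-refl = ≈-reflexive refl

  ≈-sym : ∀ {a b} → a ≈ b → b ≈ a
  ≈-sym {a} {b} (≈-intro d) = ≈-intro (subst (+ p S.∣_) (lemma a b) (S.∣m⇒∣-m d))
    where lemma : ∀ a b → - (a - b) ≡ b - a
          lemma = solve-∀

  ≈-trans : ∀ {a b c} → a ≈ b → b ≈ c → a ≈ c
  ≈-trans {a} {b} {c} (≈-intro d) (≈-intro e) = ≈-intro (subst (+ p S.∣_) (lemma a b c) (S.∣m∣n⇒∣m+n d e))
    where lemma : ∀ a b c → (a - b) + (b - c) ≡ a - c
          lemma = solve-∀

  ≈-isEquivalence : IsEquivalence _≈_
  ≈-isEquivalence = record { refl = ≈-refl ; sym = ≈-sym ; trans = ≈-trans }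

  ≈-setoid : Setoid _ _
  ≈-setoid = record { isEquivalence = ≈-isEquivalence }

  module ≈-Reasoning = Relation.Binary.Reasoning.Setoid ≈-setoid

  +-cong : ∀ {a b c d} → a ≈ b → c ≈ d → a + c ≈ b + d
  +-cong {a} {b} {c} {d} (≈-intro x) (≈-intro y) = ≈-intro (subst (+ p S.∣_) (lemma a b c d) (S.∣m∣n⇒∣m+n x y))
    where lemma : ∀ a b c d → (a - b) + (c - d) ≡ (a + c) - (b + d)
          lemma = solve-∀

  *-cong : ∀ {a b c d} → a ≈ b → c ≈ d → a * c ≈ b * d
  *-cong {a} {b} {c} {d} (≈-intro x) (≈-intro y) =
    ≈-intro (subst (+ p S.∣_) (lemma a b c d) (S.∣m∣n⇒∣m+n (S.∣m⇒∣m*n c x) (S.∣n⇒∣m*n b y)))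
    where lemma : ∀ a b c d → (a - b) * c + b * (c - d) ≡ a * c - b * d
          lemma = solve-∀

  *-congˡ : ∀ a {b c} → b ≈ c → a * b ≈ a * c
  *-congˡ a = *-cong (≈-refl {a})

  -‿cong : ∀ {a b} → a ≈ b → - a ≈ - b
  -‿cong {a} {b} (≈-intro x) = ≈-intro (subst (+ p S.∣_) (lemma a b) (S.∣m⇒∣-m x))
    where lemma : ∀ a b → - (a - b) ≡ - a - - b
          lemma = solve-∀

  ∑-cong≈ : {A : Set} (xs : List A) {g h : A → ℤ} → (∀ x → g x ≈ h x) → ∑ xs g ≈ ∑ xs h
  ∑-cong≈ [] e = ≈-refl
  ∑-cong≈ (x ∷ xs) e = +-cong (e x) (∑-cong≈ xs e)

  prodFin-cong≈ : ∀ {l} {g h : Fin l → ℤ} → (∀ t → g t ≈ h t) → prodFin g ≈ prodFin h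
  prodFin-cong≈ {zero} e = ≈-refl
  prodFin-cong≈ {suc l} e = *-cong (e zero) (prodFin-cong≈ (λ t → e (suc t)))

  prodFin≈0 : ∀ {l} (g : Fin l → ℤ) (t : Fin l) → g t ≈ 0ℤ → prodFin g ≈ 0ℤ
  prodFin≈0 g zero e = ≈-trans (*-cong e (≈-refl {prodFin (tail g)})) (≈-reflexive (ℤP.*-zeroˡ (prodFin (tail g))))
  prodFin≈0 g (suc t) e = ≈-trans (*-cong (≈-refl {g zero}) (prodFin≈0 (λ u → g (suc u)) t e))
                                  (≈-reflexive (ℤP.*-zeroʳ (g zero)))

  ∑<≈0 : ∀ n (g : ℕ → ℤ) → (∀ j → j < n → g j ≈ 0ℤ) → ∑< n g ≈ 0ℤ
  ∑<≈0 zero g _ = ≈-refl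
  ∑<≈0 (suc n) g g≈0 = +-cong (g≈0 0 (s≤s z≤n)) (∑<≈0 n (g ∘ suc) (λ j j<n → g≈0 (suc j) (s≤s j<n)))

  negOnePow*coverSum≈coverSum : ∀ k {l} (m : Fin l → ℕ) (c : Fin k → Fin l → ℤ) → (∀ t → negOnePow (m t) ≈ 1ℤ) →
                                sumFinℕ m ≤ k → negOnePow k * coverSum k m c ≈ coverSum k m c
  negOnePow*coverSum≈coverSum k {l} m c sign≈1 Σm≤k with ℕP.m<1+n⇒m<n∨m≡n (s≤s Σm≤k)
  ... | inj₁ Σm<k = ≈-reflexive (begin
    negOnePow k * coverSum k m c ≡⟨ cong (negOnePow k *_) (coverSum-vanishes k m c Σm<k) ⟩
    negOnePow k * 0ℤ             ≡⟨ ℤP.*-zeroʳ (negOnePow k) ⟩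
    0ℤ                           ≡⟨ coverSum-vanishes k m c Σm<k ⟨
    coverSum k m c               ∎)
    where open ≡-Reasoning
  ... | inj₂ refl = begin
    negOnePow (sumFinℕ m) * coverSum k m c                ≡⟨ cong (_* coverSum k m c) (negOnePow-sumFinℕ m) ⟩
    prodFin (λ t → negOnePow (m t)) * coverSum k m c      ≈⟨ *-cong (prodFin-cong≈ sign≈1) (≈-refl {coverSum k m c}) ⟩
    prodFin {l} (λ _ → 1ℤ) * coverSum k m c               ≡⟨ cong (_* coverSum k m c) (prodFin-1 l) ⟩
    1ℤ * coverSum k m c                                   ≡⟨ ℤP.*-identityˡ _ ⟩
    coverSum k m c                                        ∎
    where open ≈-Reasoning

module Degree (p : ℕ) where
  open Modulo p

  record Deg≤ (m : ℕ) (f : Fn) : Set where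
    constructor deg≤
    field Δ^suc≈0 : ∀ x → Δ^ (suc m) f x ≈ 0ℤ
  open Deg≤ public

  leading : ℕ → Fn → ℤ
  leading m f = Δ^ m f 0ℤ

  module _ (g : Fn) (L : ℤ) (Δ₁g≈L : ∀ x → Δ 1ℤ g x ≈ L) where

    Δ₊-linear : ∀ n x → Δ (+ n) g x ≈ + n * L
    Δ₊-linear zero x = ≈-reflexive (begin
      g (+ 0 + x) - g x  ≡⟨ cong (λ y → g y - g x) (ℤP.+-identityˡ x) ⟩
      g x - g x          ≡⟨ ℤP.+-inverseʳ (g x) ⟩
      0ℤ                 ≡⟨ ℤP.*-zeroˡ L ⟨
      + 0 * L            ∎)
      where open ≡-Reasoning
    Δ₊-linear (suc n) x = begin
      Δ (+ suc n) g x                    ≡⟨ cong (λ y → g y - g x) (ℤP.+-assoc 1ℤ (+ n) x) ⟩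
      g (1ℤ + (+ n + x)) - g x           ≡⟨ telescope (g (1ℤ + (+ n + x))) (g (+ n + x)) (g x) ⟩
      Δ 1ℤ g (+ n + x) + Δ (+ n) g x     ≈⟨ +-cong (Δ₁g≈L (+ n + x)) (Δ₊-linear n x) ⟩
      L + + n * L                        ≡⟨ collect (+ n) L ⟩
      + suc n * L                        ∎
      where
      open ≈-Reasoning
      telescope : ∀ a b c → a - c ≡ (a - b) + (b - c)
      telescope = solve-∀
      collect : ∀ n L → L + n * L ≡ (1ℤ + n) * L
      collect = solve-∀

    Δ-linear : ∀ c x → Δ c g x ≈ c * L
    Δ-linear (+ n) x = Δ₊-linear n x
    Δ-linear -[1+ n ] x = begin
      Δ -[1+ n ] g x                                  ≡⟨ flip (g (-[1+ n ] + x)) (g x) ⟩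
      - (g x - g (-[1+ n ] + x))                      ≡⟨ cong (λ y → - (g y - g (-[1+ n ] + x))) (cancel (+ suc n) x) ⟨
      - Δ (+ suc n) g (-[1+ n ] + x)                  ≈⟨ -‿cong (Δ₊-linear (suc n) (-[1+ n ] + x)) ⟩
      - (+ suc n * L)                                 ≡⟨ ℤP.neg-distribˡ-* (+ suc n) L ⟩
      -[1+ n ] * L                                    ∎
      where
      open ≈-Reasoning
      flip : ∀ a b → a - b ≡ - (b - a)
      flip = solve-∀
      cancel : ∀ a x → a + (- a + x) ≡ x
      cancel = solve-∀

  Δ^-Δ₁ : ∀ m (f : Fn) x → Δ 1ℤ (Δ^ m f) x ≡ Δ^ (suc m) f x
  Δ^-Δ₁ m f x = sym (Δ^-Δ-comm m 1ℤ f x)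

  Deg≤⇒Δ[Δ^]≈0 : ∀ {m f} → Deg≤ m f → ∀ a x → Δ a (Δ^ m f) x ≈ 0ℤ
  Deg≤⇒Δ[Δ^]≈0 {m} {f} deg a x =
    ≈-trans (Δ-linear (Δ^ m f) 0ℤ (λ y → ≈-trans (≈-reflexive (Δ^-Δ₁ m f y)) (Δ^suc≈0 deg y)) a x)
            (≈-reflexive (ℤP.*-zeroʳ a))

  Deg≤⇒Δ^≈leading : ∀ {m f} → Deg≤ m f → ∀ x → Δ^ m f x ≈ leading m f
  Deg≤⇒Δ^≈leading {m} {f} deg x = begin
    Δ^ m f x                                 ≡⟨ cong (Δ^ m f) (ℤP.+-identityʳ x) ⟨
    Δ^ m f (x + 0ℤ)                          ≡⟨ recombine (Δ^ m f (x + 0ℤ)) (Δ^ m f 0ℤ) ⟩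
    Δ x (Δ^ m f) 0ℤ + leading m f            ≈⟨ +-cong (Deg≤⇒Δ[Δ^]≈0 deg x 0ℤ) (≈-refl {leading m f}) ⟩
    0ℤ + leading m f                         ≡⟨ ℤP.+-identityˡ _ ⟩
    leading m f                              ∎
    where
    open ≈-Reasoning
    recombine : ∀ a b → a ≡ (a - b) + b
    recombine = solve-∀

  Deg≤-Δ : ∀ {m f} → Deg≤ (suc m) f → ∀ a → Deg≤ m (Δ a f)
  Deg≤-Δ {m} {f} deg a = deg≤ λ x → ≈-trans (≈-reflexive (Δ^-Δ-comm (suc m) a f x)) (Deg≤⇒Δ[Δ^]≈0 deg a x)

  leading-Δ : ∀ {m f} → Deg≤ (suc m) f → ∀ a → leading m (Δ a f) ≈ a * leading (suc m) f
  leading-Δ {m} {f} deg a = ≈-trans (≈-reflexive (Δ^-Δ-comm m a f 0ℤ))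
    (Δ-linear (Δ^ m f) (leading (suc m) f) (λ y → ≈-trans (≈-reflexive (Δ^-Δ₁ m f y)) (Deg≤⇒Δ^≈leading deg y)) a 0ℤ)

  hits-leading : ∀ {q} N d → q ≡ suc N → Deg≤ N (hits q d) → leading N (hits q d) ≈ 1ℤ
  hits-leading N d refl deg = ≈-trans (≈-sym (Deg≤⇒Δ^≈leading deg (1ℤ + d)))
    (≈-reflexive (trans (Δ^-initial-zeros N (hits (suc N) d) (1ℤ + d) zeros) top))
    where
    shift : ∀ j d → (j + (1ℤ + d)) - d ≡ 1ℤ + j
    shift = solve-∀
    zeros : ∀ j → j < N → hits (suc N) d (+ j + (1ℤ + d)) ≡ 0ℤ
    zeros j j<N = cong 𝟙 (trans (cong (λ y → does (+ suc N ∣ℤ? y)) (shift (+ j) d))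
                                (dec-false (suc N ℕD.∣? suc j) (λ N∣j → ℕP.<⇒≱ (s≤s j<N) (ℕD.∣⇒≤ N∣j))))
    top : hits (suc N) d (+ N + (1ℤ + d)) ≡ 1ℤ
    top = cong 𝟙 (trans (cong (λ y → does (+ suc N ∣ℤ? y)) (shift (+ N) d))
                        (dec-true (suc N ℕD.∣? suc N) ℕD.∣-refl))

  module _ {n : ℕ} {g : Fn} (a : ℤ) where

    Deg≤-if-Δ : ∀ β → bit β ≤ n → Deg≤ n g → Deg≤ (n ∸ bit β) (λ y → if β then Δ a g y else g y)
    Deg≤-if-Δ true (s≤s _) deg = Deg≤-Δ deg a
    Deg≤-if-Δ false _ deg = deg

    leading-if-Δ : ∀ β → bit β ≤ n → Deg≤ n g →
      leading (n ∸ bit β) (λ y → if β then Δ a g y else g y) ≈ (if β then a else 1ℤ) * leading n g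
    leading-if-Δ true (s≤s _) deg = leading-Δ deg a
    leading-if-Δ false _ deg = ≈-reflexive (sym (ℤP.*-identityˡ (leading n g)))

  if-Δ≈0 : ∀ β {n g} a → ¬ bit β ≤ n → Deg≤ n g → ∀ y → (if β then Δ a g y else g y) ≈ 0ℤ
  if-Δ≈0 true {zero} a _ deg y = Deg≤⇒Δ[Δ^]≈0 deg a y
  if-Δ≈0 true {suc n} a 1≰ _ y = ⊥-elim (1≰ (s≤s z≤n))
  if-Δ≈0 false a 0≰ _ y = ⊥-elim (0≰ z≤n)

  module _ {l : ℕ} {f : Fin l → Fn} {m : Fin l → ℕ} (deg : ∀ t → Deg≤ (m t) (f t)) (a : Fin l → ℤ) (b : Fin l → Bool) where

    Deg≤-selectiveΔ : b ≼ m → ∀ t → Deg≤ ((m ∸ᵇ b) t) (selectiveΔ f a b t)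
    Deg≤-selectiveΔ b≼m t = Deg≤-if-Δ (a t) (b t) (b≼m t) (deg t)

    leadings-selectiveΔ : b ≼ m →
      prodFin (λ t → leading ((m ∸ᵇ b) t) (selectiveΔ f a b t)) ≈ choose (λ _ → 1ℤ) a b * prodFin (λ t → leading (m t) (f t))
    leadings-selectiveΔ b≼m = ≈-trans (prodFin-cong≈ λ t → leading-if-Δ (a t) (b t) (b≼m t) (deg t))
      (≈-reflexive (prodFin-* (λ t → if b t then a t else 1ℤ) (λ t → leading (m t) (f t))))

    alternatingSum-selectiveΔ≈0 : ¬ b ≼ m → ∀ k (c : Fin k → Fin l → ℤ) → alternatingSum k (selectiveΔ f a b) c ≈ 0ℤ
    alternatingSum-selectiveΔ≈0 b⋠m k c with ¬∀⟶∃¬ l _ (λ t → bit (b t) ℕ.≤? m t) b⋠m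
    ... | t , b⋠m-at-t = ≈-trans
      (∑-cong≈ (allSubsets k) λ I → *-congˡ (negOnePow ∣ I ∣) (prodFin≈0 _ t (if-Δ≈0 (b t) (a t) b⋠m-at-t (deg t) _)))
      (≈-reflexive (trans (∑-cong (allSubsets k) λ I → ℤP.*-zeroʳ (negOnePow ∣ I ∣)) (∑-0 (allSubsets k))))

  alternatingSum-zero : ∀ {l} (f : Fin l → Fn) (m : Fin l → ℕ) (c : Fin 0 → Fin l → ℤ) → (∀ t → m t ≡ 0) →
    alternatingSum 0 f c ≡ negOnePow 0 * (coverSum 0 m c * prodFin (λ t → leading (m t) (f t)))
  alternatingSum-zero f m c m≡0 = begin
    1ℤ * prodFin (λ t → f t 0ℤ) + 0ℤ
      ≡⟨ trans (ℤP.+-identityʳ _) (ℤP.*-identityˡ _) ⟩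
    prodFin (λ t → f t 0ℤ)
      ≡⟨ prodFin-cong (λ t → cong (λ n → leading n (f t)) (m≡0 t)) ⟨
    prodFin (λ t → leading (m t) (f t))
      ≡⟨ trans (sym (ℤP.*-identityˡ _)) (sym (ℤP.*-identityˡ _)) ⟩
    1ℤ * (1ℤ * prodFin (λ t → leading (m t) (f t)))
      ≡⟨ cong (λ x → 1ℤ * (x * prodFin (λ t → leading (m t) (f t)))) (coverSum-zero m c m≡0) ⟨
    1ℤ * (coverSum 0 m c * prodFin (λ t → leading (m t) (f t))) ∎
    where open ≡-Reasoning

  alternatingSum≈ : ∀ k {l} (f : Fin l → Fn) (m : Fin l → ℕ) → (∀ t → Deg≤ (m t) (f t)) → sumFinℕ m ≤ k →
    (c : Fin k → Fin l → ℤ) →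
    alternatingSum k f c ≈ negOnePow k * (coverSum k m c * prodFin (λ t → leading (m t) (f t)))
  alternatingSum≈ zero f m deg Σm≤0 c =
    ≈-reflexive (alternatingSum-zero f m c (sumFinℕ≡0⇒≡0 m (ℕP.n≤0⇒n≡0 Σm≤0)))
  alternatingSum≈ (suc k) {l} f m deg Σm≤1+k c = begin
    alternatingSum (suc k) f c
      ≡⟨ alternatingSum-suc k f c ⟩
    - ∑[ b ← selections l ] (𝟙 (or b) * alternatingSum k (selectiveΔ f (c zero) b) (tail c))
      ≈⟨ -‿cong (∑-cong≈ (selections l) term) ⟩
    - ∑[ b ← selections l ] ((negOnePow k * Λ) * (𝟙 (or b) * (𝟙 (does (b ≼? m)) * rest b)))
      ≡⟨ cong -_ (∑-*ˡ (selections l) (negOnePow k * Λ) _) ⟩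
    - ((negOnePow k * Λ) * ∑[ b ← selections l ] (𝟙 (or b) * (𝟙 (does (b ≼? m)) * rest b)))
      ≡⟨ cong (λ x → - ((negOnePow k * Λ) * x)) (coverSum-suc k m c) ⟨
    - ((negOnePow k * Λ) * coverSum (suc k) m c)
      ≡⟨ rearrange (negOnePow k) Λ (coverSum (suc k) m c) ⟩
    negOnePow (suc k) * (coverSum (suc k) m c * Λ) ∎
    where
    open ≈-Reasoning
    Λ = prodFin (λ t → leading (m t) (f t))
    rest : (Fin l → Bool) → ℤ
    rest b = choose (λ _ → 1ℤ) (c zero) b * coverSum k (m ∸ᵇ b) (tail c)
    rearrange : ∀ n L s → - ((n * L) * s) ≡ (- n) * (s * L)
    rearrange = solve-∀
    vanish : ∀ a r → a * (0ℤ * r) ≡ 0ℤ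
    vanish = solve-∀
    regroup : ∀ n s x y → n * (s * (x * y)) ≡ (n * y) * (1ℤ * (1ℤ * (x * s)))
    regroup = solve-∀
    term : ∀ b → 𝟙 (or b) * alternatingSum k (selectiveΔ f (c zero) b) (tail c)
                 ≈ (negOnePow k * Λ) * (𝟙 (or b) * (𝟙 (does (b ≼? m)) * rest b))
    term b with or b in or≡ | b ≼? m
    ... | false | _ = ≈-reflexive (trans (ℤP.*-zeroˡ (alternatingSum k (selectiveΔ f (c zero) b) (tail c)))
                                         (sym (vanish (negOnePow k * Λ) (𝟙 (does (b ≼? m)) * rest b))))
    ... | true | yes b≼m = begin
      1ℤ * alternatingSum k (selectiveΔ f (c zero) b) (tail c)
        ≡⟨ ℤP.*-identityˡ _ ⟩
      alternatingSum k (selectiveΔ f (c zero) b) (tail c)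
        ≈⟨ alternatingSum≈ k (selectiveΔ f (c zero) b) (m ∸ᵇ b) (Deg≤-selectiveΔ deg (c zero) b b≼m) Σ≤k (tail c) ⟩
      negOnePow k * (S * prodFin (λ t → leading ((m ∸ᵇ b) t) (selectiveΔ f (c zero) b t)))
        ≈⟨ *-congˡ (negOnePow k) (*-congˡ S (leadings-selectiveΔ deg (c zero) b b≼m)) ⟩
      negOnePow k * (S * (C * Λ))
        ≡⟨ regroup (negOnePow k) S C Λ ⟩
      (negOnePow k * Λ) * (1ℤ * (1ℤ * (C * S)))
        ≡⟨ cong (λ x → (negOnePow k * Λ) * (1ℤ * (𝟙 x * rest b))) (dec-true (b ≼? m) b≼m) ⟨
      (negOnePow k * Λ) * (1ℤ * (𝟙 (does (b ≼? m)) * rest b)) ∎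
      where
      S = coverSum k (m ∸ᵇ b) (tail c)
      C = choose (λ _ → 1ℤ) (c zero) b
      Σ≤k : sumFinℕ (m ∸ᵇ b) ≤ k
      Σ≤k = ℕP.≤-pred (ℕP.≤-trans (sum-∸ᵇ< m b or≡ b≼m) Σm≤1+k)
    ... | true | no b⋠m = begin
      1ℤ * alternatingSum k (selectiveΔ f (c zero) b) (tail c)
        ≈⟨ *-congˡ 1ℤ (alternatingSum-selectiveΔ≈0 deg (c zero) b b⋠m k (tail c)) ⟩
      0ℤ
        ≡⟨ trans (cong ((negOnePow k * Λ) *_) (ℤP.*-identityˡ (0ℤ * rest b))) (vanish (negOnePow k * Λ) (rest b)) ⟨
      (negOnePow k * Λ) * (1ℤ * (0ℤ * rest b))
        ≡⟨ cong (λ x → (negOnePow k * Λ) * (1ℤ * (𝟙 x * rest b))) (dec-false (b ≼? m) b⋠m) ⟨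
      (negOnePow k * Λ) * (1ℤ * (𝟙 (does (b ≼? m)) * rest b)) ∎

module PrimePower (p : ℕ) (p-prime : Prime p) where
  open Modulo p
  open Degree p

  -- p^h = N + 1 divides (j + 1) * Δcoeff (N + 1) (j + 1), but not j + 1 < p^h.
  p∣Δcoeff : ∀ {h N j} → p ^ h ≡ suc N → j < N → + p S.∣ Δcoeff (suc N) (suc j)
  p∣Δcoeff {h} {N} {j} pʰ≡1+N j<N with p ℕD.∣? ℤ.∣ Δcoeff (suc N) (suc j) ∣
  ... | yes p∣ = S.∣ᵤ⇒∣ p∣
  ... | no p∤ =
    ⊥-elim (ℕP.<⇒≱ (s≤s j<N) (subst (_≤ suc j) pʰ≡1+N (ℕD.∣⇒≤ (prime-power∣*⇒∣ p-prime h pʰ∣ p∤))))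
    where
    absorbed : suc N ℕ.* ℤ.∣ Δcoeff N j ∣ ≡ suc j ℕ.* ℤ.∣ Δcoeff (suc N) (suc j) ∣
    absorbed = trans (sym (ℤP.abs-* (+ suc N) (Δcoeff N j)))
                     (trans (cong ℤ.∣_∣ (sym (Δcoeff-absorption N j))) (ℤP.abs-* (+ suc j) (Δcoeff (suc N) (suc j))))
    pʰ∣ : p ^ h ℕD.∣ suc j ℕ.* ℤ.∣ Δcoeff (suc N) (suc j) ∣
    pʰ∣ = subst (p ^ h ℕD.∣_) absorbed (subst (ℕD._∣ suc N ℕ.* _) (sym pʰ≡1+N) (ℕD.m∣m*n _))

  module _ (h : ℕ) {N : ℕ} (pʰ≡1+N : p ^ h ≡ suc N) where

    Δ^-endpoints : ∀ f x → Δ^ (suc N) f x ≈ negOnePow (suc N) * f x + f (+ suc N + x)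
    Δ^-endpoints f x = begin
      Δ^ (suc N) f x                         ≡⟨ Δ^-expansion (suc N) f x ⟩
      g 0 + ∑< (suc N) (g ∘ suc)             ≡⟨ cong (_+_ (g 0)) (∑<-last N (g ∘ suc)) ⟩
      g 0 + (∑< N (g ∘ suc) + g (suc N))     ≈⟨ +-cong (≈-refl {g 0}) (+-cong middle (≈-refl {g (suc N)})) ⟩
      g 0 + (0ℤ + g (suc N))                 ≡⟨ cong₂ (λ a b → a + (0ℤ + b)) first last ⟩
      negOnePow (suc N) * f x + (0ℤ + 1ℤ * f (+ suc N + x))
                                             ≡⟨ cong (_+_ (negOnePow (suc N) * f x)) (trans (ℤP.+-identityˡ _) (ℤP.*-identityˡ _)) ⟩
      negOnePow (suc N) * f x + f (+ suc N + x) ∎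
      where
      open ≈-Reasoning
      g : ℕ → ℤ
      g j = Δcoeff (suc N) j * f (+ j + x)
      middle : ∑< N (g ∘ suc) ≈ 0ℤ
      middle = ∑<≈0 N (g ∘ suc) λ j j<N → ∣⇒≈0 (S.∣m⇒∣m*n (f (+ suc j + x)) (p∣Δcoeff {h} pʰ≡1+N j<N))
      first : g 0 ≡ negOnePow (suc N) * f x
      first = cong₂ _*_ (Δcoeff-zero (suc N)) (cong f (ℤP.+-identityˡ x))
      last : g (suc N) ≡ 1ℤ * f (+ suc N + x)
      last = cong (_* f (+ suc N + x)) (Δcoeff-diagonal (suc N))

    -- Δ^-endpoints for a constant function, whose (N+1)-th difference is 0.
    negOnePow≈-1 : negOnePow (suc N) ≈ - 1ℤ
    negOnePow≈-1 = begin
      negOnePow (suc N)                    ≡⟨ unshift (negOnePow (suc N)) ⟩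
      (negOnePow (suc N) * 1ℤ + 1ℤ) - 1ℤ   ≈⟨ +-cong sum≈0 (≈-refl { - 1ℤ}) ⟩
      0ℤ - 1ℤ                              ≡⟨⟩
      - 1ℤ                                 ∎
      where
      open ≈-Reasoning
      unshift : ∀ a → a ≡ (a * 1ℤ + 1ℤ) - 1ℤ
      unshift = solve-∀
      sum≈0 : negOnePow (suc N) * 1ℤ + 1ℤ ≈ 0ℤ
      sum≈0 = ≈-trans (≈-sym (Δ^-endpoints (λ _ → 1ℤ) 0ℤ)) (≈-reflexive (Δ^-const N 1ℤ 0ℤ))

    Δ^-prime-power : ∀ f x → Δ^ (suc N) f x ≈ f (+ suc N + x) - f x
    Δ^-prime-power f x = ≈-trans (Δ^-endpoints f x)
      (≈-trans (+-cong (*-cong negOnePow≈-1 (≈-refl {f x})) (≈-refl {f (+ suc N + x)}))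
               (≈-reflexive (flip (f x) (f (+ suc N + x)))))
      where flip : ∀ a b → (- 1ℤ) * a + b ≡ b - a
            flip = solve-∀

    periodic⇒Deg≤ : ∀ {f} → (∀ x → f (+ (p ^ h) + x) ≡ f x) → Deg≤ N f
    periodic⇒Deg≤ {f} periodic = deg≤ λ x → ≈-trans (Δ^-prime-power f x) (≈-reflexive (begin
      f (+ suc N + x) - f x    ≡⟨ cong (λ q → f (+ q + x) - f x) pʰ≡1+N ⟨
      f (+ (p ^ h) + x) - f x  ≡⟨ cong (_- f x) (periodic x) ⟩
      f x - f x                ≡⟨ ℤP.+-inverseʳ (f x) ⟩
      0ℤ                       ∎))
      where open ≡-Reasoning

  p^h≡suc[p^h∸1] : ∀ h → p ^ h ≡ suc (p ^ h ∸ 1)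
  p^h≡suc[p^h∸1] h = sym (ℕP.suc-pred (p ^ h) {{ℕP.m^n≢0 p h {{prime⇒nonZero p-prime}}}})

  Deg≤-hits : ∀ h d → Deg≤ (p ^ h ∸ 1) (hits (p ^ h) d)
  Deg≤-hits h d = periodic⇒Deg≤ h (p^h≡suc[p^h∸1] h) (hits-periodic (p ^ h) d)

  leading-hits≈1 : ∀ h d → leading (p ^ h ∸ 1) (hits (p ^ h) d) ≈ 1ℤ
  leading-hits≈1 h d = hits-leading (p ^ h ∸ 1) d (p^h≡suc[p^h∸1] h) (Deg≤-hits h d)

  negOnePow[p^h∸1]≈1 : ∀ h → negOnePow (p ^ h ∸ 1) ≈ 1ℤ
  negOnePow[p^h∸1]≈1 h =
    ≈-trans (≈-reflexive (sym (ℤP.neg-involutive _))) (-‿cong (negOnePow≈-1 h (p^h≡suc[p^h∸1] h)))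

theorem3p2 : (p : ℕ) → Prime p → (k l : ℕ) → (h : Fin l → ℕ)
    → 1 ≤ k → (∀ t → 1 ≤ h t)
    → sumFinℕ (λ t → p ^ h t ∸ 1) ≤ k
    → (c : Fin k → Fin l → ℤ) → (d : Fin l → ℤ)
    → (+ p) ℤD.∣
        (sumℤ (map (λ I → negOnePow ∣ I ∣)
                (filter (λ I → all? (λ t → (+ (p ^ h t)) ∣ℤ? (sumOver I (λ s → c s t) ℤ.- d t)))
                        (allSubsets k)))
         ℤ.- sumℤ (map (λ J → prodFin (λ t → prodOver (J t) (λ s → c s t)))
                    (filter (λ J → ≡-dec _≟_ (unionFin J) ⊤ ×-dec all? (λ t → ℕ._≟_ ∣ J t ∣ (p ^ h t ∸ 1)))
                            (allTuples l (allSubsets k)))))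
theorem3p2 p p-prime k l h _ _ Σm≤k c d = S.∣⇒∣ᵤ (p∣a-b (≈-trans
  (≈-reflexive (∑-filter-divisible≡alternatingSum k (λ t → p ^ h t) d c)) (begin
    alternatingSum k f c
      ≈⟨ alternatingSum≈ k f m (λ t → Deg≤-hits (h t) (d t)) Σm≤k c ⟩
    negOnePow k * (coverSum k m c * prodFin (λ t → leading (m t) (f t)))
      ≈⟨ *-congˡ (negOnePow k) (*-congˡ (coverSum k m c) (prodFin-cong≈ λ t → leading-hits≈1 (h t) (d t))) ⟩
    negOnePow k * (coverSum k m c * prodFin {l} (λ _ → 1ℤ))
      ≡⟨ cong (λ x → negOnePow k * (coverSum k m c * x)) (prodFin-1 l) ⟩
    negOnePow k * (coverSum k m c * 1ℤ)
      ≡⟨ cong (negOnePow k *_) (ℤP.*-identityʳ _) ⟩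
    negOnePow k * coverSum k m c
      ≈⟨ negOnePow*coverSum≈coverSum k m c (λ t → negOnePow[p^h∸1]≈1 (h t)) Σm≤k ⟩
    coverSum k m c ∎)))
  where
  open Modulo p
  open Degree p
  open PrimePower p p-prime
  open ≈-Reasoning
  m : Fin l → ℕ
  m t = p ^ h t ∸ 1
  f : Fin l → Fn
  f t = hits (p ^ h t) (d t)
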